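{- For any prime $p>3$, $$\sum_{k=1}^{p-1}\frac{\binom{2k}{k}}{k3^k}\equiv\frac{3^{p-1}-1}{p}\pmod p.$$
   Context: Congruences modulo $p$ are between rational numbers whose denominators are prime to $p$. -}

module Defs where

open import Data.Nat using (ℕ; zero; suc; _∸_; _^_; NonZero)
import Data.Nat as ℕ
import Data.Nat.Properties as ℕP
open import Data.Nat.Combinatorics using (_C_)
open import Data.Nat.Divisibility using (_∣_)
open import Data.Integer using (ℤ; +_; ∣_∣)
import Data.Integer as ℤ
open import Data.Rational using (ℚ; _/_; _+_; _-_; 0ℚ; ↥_; ↧ₙ_)
open import Data.Product using (_×_)
open import Relation.Nullary using (¬_)

-- a rational number is p-integral: its reduced denominator is prime to p
-- (for p prime this is the same as "p does not divide the denominator")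
pIntegral : ℕ → ℚ → Set
pIntegral p x = ¬ (p ∣ ↧ₙ x)

_≡_[modℚ_] : ℚ → ℚ → ℕ → Set
a ≡ b [modℚ p ] = pIntegral p a × pIntegral p b × (p ∣ ∣ ↥ (a - b) ∣)

sumFrom1 : ℕ → (ℕ → ℚ) → ℚ
sumFrom1 zero    f = 0ℚ
sumFrom1 (suc n) f = sumFrom1 n f + f (suc n)

term : ℕ → ℚ
term zero    = 0ℚ
term (suc j) = (+ ((2 ℕ.* suc j) C suc j)) / (suc j ℕ.* (3 ^ suc j))
  where instance
    nz : NonZero (suc j ℕ.* (3 ^ suc j))
    nz = ℕP.m*n≢0 (suc j) (3 ^ suc j) {{_}} {{ℕP.m^n≢0 3 (suc j)}}

fermatQuot3 : (p : ℕ) → .{{NonZero p}} → ℚ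
fermatQuot3 p = (+ (3 ^ (p ∸ 1)) ℤ.- + 1) / p

module Submission where

-- Write p = 2n + 1, ζ = −1/3 and L_n(z) = Σ_{k=1}^n z^k/k.
--  1. Modulo p, C(2k,k) ≡ C(n,k)(−4)^k for k ≤ n and C(2k,k) ≡ 0 for n < k < p.  With the
--     exact identity Σ_{k=1}^m C(m,k) x^k/k = L_m(1+x) − L_m(1) at x = −4/3 the sum becomes
--     L_n(ζ) − L_n(1).
--  2. Modulo p, C(p−1, 2i−1) ≡ −1, while 2i C(p,2i) = p C(p−1,2i−1) exactly.  Hence the even
--     part E_p(z) = Σ_i C(p,2i) z^i of (1+√z)^p equals 1 + p·W(z)/2 with W(z) ≡ −L_n(z).
--  3. (1+√ζ)^6 = −64/27 gives the norm relation 3^n E_p(ζ) = ±E_p(1) = ±4^n (as 3 ∤ p).  With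
--     c = 3^n this reads c(1 + p W(ζ)/2) = ±(1 + p W(1)/2), which forces c ≡ ±1 and then
--     (c² − 1)/p ≡ W(1) − W(ζ) ≡ L_n(ζ) − L_n(1).

open import Defs
open import Data.Nat using (ℕ; _∸_; _>_)
open import Data.Nat.Primality using (Prime; prime⇒nonZero)
open import Data.Nat.Primality using (euclidsLemma; prime⇒nonTrivial; prime⇒irreducible)

open import Algebra.Bundles using (CommutativeRing)
open import Data.Nat as ℕ using (zero; suc; NonZero)
import Data.Nat.Properties as ℕP
import Data.Nat.Coprimality as Coprime
open import Data.Integer as ℤ using (ℤ; +_)
import Data.Integer.Properties as ℤP
open import Data.Rational using (ℚ; mkℚ; _/_; ↥_; ↧_; ↧ₙ_; 0ℚ; 1ℚ; _+_; _*_; _-_; -_)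
import Data.Rational.Properties as ℚP
open import Data.Rational.Unnormalised using (mkℚᵘ; *≡*)
open import Data.Rational.Solver using (module +-*-Solver)
open +-*-Solver using (solve; _:+_; _:*_; :-_; _:-_; con; _:=_)
open import Relation.Binary.PropositionalEquality
open import Data.Product using (Σ; _,_; _×_; proj₁)
open import Data.Sum using (_⊎_; inj₁; inj₂; [_,_]′)
open import Relation.Nullary using (¬_; contradiction)
open import Level using (0ℓ)
open import Relation.Binary.Bundles using (Setoid)
import Relation.Binary.Reasoning.Setoid as SetoidReasoning
import Data.Nat.GCD as NatGCD
open import Data.Integer.GCD using (gcd)
open import Data.Nat.Divisibility as ℕD using (_∣_; divides)
open import Data.Nat.Combinatorics using (_C_; nCk+nC[k+1]≡[n+1]C[k+1])
import Data.Nat.Solver as NatSolver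

open import Algebra.Properties.CommutativeSemiring.Exp
  (CommutativeRing.commutativeSemiring ℚP.+-*-commutativeRing)
  using (_^_; ^-homo-*; ^-distrib-*)

ι : ℤ → ℚ
ι i = mkℚ i 0 (Coprime.sym (Coprime.1-coprimeTo ℤ.∣ i ∣))

⟦_⟧ : ℕ → ℚ
⟦ n ⟧ = ι (+ n)

1/[1+_] : ℕ → ℚ
1/[1+ m ] = mkℚ (+ 1) m (Coprime.1-coprimeTo (suc m))

ι≡/1 : ∀ i → i / 1 ≡ ι i
ι≡/1 i = ℚP.↥p/↧p≡p (ι i)

ι*1/[1+_] : ∀ i m → ι i * 1/[1+ m ] ≡ i / suc m
ι*1/[1+_] i m = ℚP./-cong (ℤP.*-identityʳ i) (ℕP.+-identityʳ (suc m))

/-cross : ∀ a b m n → a ℤ.* + suc n ≡ b ℤ.* + suc m → a / suc m ≡ b / suc n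
/-cross a b m n eq = ℚP.fromℚᵘ-cong {mkℚᵘ a m} {mkℚᵘ b n} (*≡* eq)

ι-+ : ∀ i j → ι (i ℤ.+ j) ≡ ι i + ι j
ι-+ i j = sym (trans (ℚP./-cong (cong₂ ℤ._+_ (ℤP.*-identityʳ i) (ℤP.*-identityʳ j)) refl)
                     (ι≡/1 (i ℤ.+ j)))

ι-* : ∀ i j → ι (i ℤ.* j) ≡ ι i * ι j
ι-* i j = sym (ι≡/1 (i ℤ.* j))

ι-neg : ∀ i → ι (ℤ.- i) ≡ - ι i
ι-neg i = sym (trans (sym (ℚP.↥p/↧p≡p (- ι i)))
                     (trans (ℚP./-cong (ℚP.↥-neg (ι i)) (cong ℤ.∣_∣ (ℚP.↧-neg (ι i))))
                            (ι≡/1 (ℤ.- i))))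

⟦+⟧ : ∀ a b → ⟦ a ℕ.+ b ⟧ ≡ ⟦ a ⟧ + ⟦ b ⟧
⟦+⟧ a b = ι-+ (+ a) (+ b)

⟦suc⟧ : ∀ a → ⟦ suc a ⟧ ≡ 1ℚ + ⟦ a ⟧
⟦suc⟧ = ⟦+⟧ 1

⟦*⟧ : ∀ a b → ⟦ a ℕ.* b ⟧ ≡ ⟦ a ⟧ * ⟦ b ⟧
⟦*⟧ a b = trans (cong ι (ℤP.pos-* a b)) (ι-* (+ a) (+ b))

⟦^⟧ : ∀ a k → ⟦ a ℕ.^ k ⟧ ≡ ⟦ a ⟧ ^ k
⟦^⟧ a zero    = refl
⟦^⟧ a (suc k) = trans (⟦*⟧ a (a ℕ.^ k)) (cong (⟦ a ⟧ *_) (⟦^⟧ a k))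

⟦1+2k⟧ : ∀ k → ⟦ suc (k ℕ.+ k) ⟧ ≡ 1ℚ + ⟦ k ⟧ + ⟦ k ⟧
⟦1+2k⟧ k = trans (⟦suc⟧ (k ℕ.+ k))
                 (trans (cong (λ t → 1ℚ + t) (⟦+⟧ k k)) (sym (ℚP.+-assoc 1ℚ ⟦ k ⟧ ⟦ k ⟧)))

1^n≡1 : ∀ n → 1ℚ ^ n ≡ 1ℚ
1^n≡1 zero    = refl
1^n≡1 (suc n) = cong (1ℚ *_) (1^n≡1 n)

1/[1+]-inverse : ∀ m → ⟦ suc m ⟧ * 1/[1+ m ] ≡ 1ℚ
1/[1+]-inverse m = trans (ι*1/[1+ (+ suc m) ] m)
  (/-cross (+ suc m) (+ 1) m 0 (trans (ℤP.*-identityʳ (+ suc m)) (sym (ℤP.*-identityˡ (+ suc m)))))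

inverse-unique : ∀ a x y → a * x ≡ 1ℚ → a * y ≡ 1ℚ → x ≡ y
inverse-unique a x y ax≡1 ay≡1 = begin
  x            ≡⟨ sym (ℚP.*-identityʳ x) ⟩
  x * 1ℚ       ≡⟨ cong (x *_) (sym ay≡1) ⟩
  x * (a * y)  ≡⟨ solve 3 (λ a x y → x :* (a :* y) := (a :* x) :* y) refl a x y ⟩
  (a * x) * y  ≡⟨ cong (_* y) ax≡1 ⟩
  1ℚ * y       ≡⟨ ℚP.*-identityˡ y ⟩
  y            ∎
  where open ≡-Reasoning

/-by-inverse : ∀ i d .{{_ : NonZero d}} r → ⟦ d ⟧ * r ≡ 1ℚ → i / d ≡ ι i * r
/-by-inverse i (suc m) r dr≡1 =
  trans (sym (ι*1/[1+ i ] m)) (cong (ι i *_) (inverse-unique ⟦ suc m ⟧ 1/[1+ m ] r (1/[1+]-inverse m) dr≡1))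

1/[1+]-cancel : ∀ m v → 1/[1+ m ] * (⟦ suc m ⟧ * v) ≡ v
1/[1+]-cancel m v =
  trans (solve 3 (λ r a v → r :* (a :* v) := (a :* r) :* v) refl 1/[1+ m ] ⟦ suc m ⟧ v)
        (trans (cong (_* v) (1/[1+]-inverse m)) (ℚP.*-identityˡ v))

cross-divide : ∀ k m a b → ⟦ suc k ⟧ * b ≡ ⟦ suc m ⟧ * a → a * 1/[1+ k ] ≡ b * 1/[1+ m ]
cross-divide k m a b kb≡ma = begin
  a * r            ≡⟨ sym (1/[1+]-cancel m (a * r)) ⟩
  s * (M * (a * r)) ≡⟨ cong (s *_) (solve 3 (λ M a r → M :* (a :* r) := (M :* a) :* r) refl M a r) ⟩
  s * ((M * a) * r) ≡⟨ cong (λ t → s * (t * r)) (sym kb≡ma) ⟩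
  s * ((K * b) * r) ≡⟨ cong (s *_) (solve 3 (λ K b r → (K :* b) :* r := r :* (K :* b)) refl K b r) ⟩
  s * (r * (K * b)) ≡⟨ cong (s *_) (1/[1+]-cancel k b) ⟩
  s * b             ≡⟨ ℚP.*-comm s b ⟩
  b * s             ∎
  where
  open ≡-Reasoning
  r s K M : ℚ
  r = 1/[1+ k ]
  s = 1/[1+ m ]
  K = ⟦ suc k ⟧
  M = ⟦ suc m ⟧

neg-one^odd : ∀ i → (- 1ℚ) ^ suc (i ℕ.+ i) ≡ - 1ℚ
neg-one^odd i = cong (- 1ℚ *_) (trans (^-homo-* (- 1ℚ) i i)
                                      (trans (sym (^-distrib-* (- 1ℚ) (- 1ℚ) i)) (1^n≡1 i)))

Σ-cong : ∀ n {f g : ℕ → ℚ} → (∀ k → k ℕ.< n → f (suc k) ≡ g (suc k)) →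
         sumFrom1 n f ≡ sumFrom1 n g
Σ-cong zero    f≡g = refl
Σ-cong (suc n) f≡g = cong₂ _+_ (Σ-cong n (λ k k<n → f≡g k (ℕP.m<n⇒m<1+n k<n))) (f≡g n (ℕP.n<1+n n))

Σ-+ : ∀ n (f g : ℕ → ℚ) → sumFrom1 n (λ k → f k + g k) ≡ sumFrom1 n f + sumFrom1 n g
Σ-+ zero    f g = refl
Σ-+ (suc n) f g = trans (cong (_+ (f (suc n) + g (suc n))) (Σ-+ n f g))
  (solve 4 (λ a b c d → (a :+ b) :+ (c :+ d) := (a :+ c) :+ (b :+ d)) refl
           (sumFrom1 n f) (sumFrom1 n g) (f (suc n)) (g (suc n)))

Σ-* : ∀ n c (f : ℕ → ℚ) → sumFrom1 n (λ k → c * f k) ≡ c * sumFrom1 n f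
Σ-* zero    c f = sym (ℚP.*-zeroʳ c)
Σ-* (suc n) c f = trans (cong (_+ c * f (suc n)) (Σ-* n c f))
                        (sym (ℚP.*-distribˡ-+ c (sumFrom1 n f) (f (suc n))))

Σ-zero : ∀ n {f : ℕ → ℚ} → (∀ k → k ℕ.< n → f (suc k) ≡ 0ℚ) → sumFrom1 n f ≡ 0ℚ
Σ-zero zero    f≡0 = refl
Σ-zero (suc n) f≡0 =
  cong₂ _+_ (Σ-zero n (λ k k<n → f≡0 k (ℕP.m<n⇒m<1+n k<n))) (f≡0 n (ℕP.n<1+n n))

Σ-split : ∀ m n (f : ℕ → ℚ) →
          sumFrom1 (m ℕ.+ n) f ≡ sumFrom1 m f + sumFrom1 n (λ k → f (m ℕ.+ k))
Σ-split m zero    f rewrite ℕP.+-identityʳ m = sym (ℚP.+-identityʳ (sumFrom1 m f))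
Σ-split m (suc n) f rewrite ℕP.+-suc m n | Σ-split m n f =
  ℚP.+-assoc (sumFrom1 m f) (sumFrom1 n (λ k → f (m ℕ.+ k))) (f (suc (m ℕ.+ n)))

Σ-shift : ∀ n (f : ℕ → ℚ) → sumFrom1 (suc n) f ≡ f 1 + sumFrom1 n (λ k → f (suc k))
Σ-shift n f = trans (Σ-split 1 n f) (cong (_+ sumFrom1 n (λ k → f (suc k))) (ℚP.+-identityˡ (f 1)))

choose : ℕ → ℕ → ℕ
choose n       zero    = 1
choose zero    (suc k) = 0
choose (suc n) (suc k) = choose n k ℕ.+ choose n (suc k)

choose≡C : ∀ n k → choose n k ≡ n C k
choose≡C n       zero    = refl
choose≡C zero    (suc k) = refl
choose≡C (suc n) (suc k) =
  trans (cong₂ ℕ._+_ (choose≡C n k) (choose≡C n (suc k))) (nCk+nC[k+1]≡[n+1]C[k+1] n k)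

choose-zero : ∀ {m k} → m ℕ.< k → choose m k ≡ 0
choose-zero {zero}  {suc k} _           = refl
choose-zero {suc m} {suc k} (ℕ.s≤s m<k) =
  cong₂ ℕ._+_ (choose-zero m<k) (choose-zero (ℕP.m<n⇒m<1+n m<k))

choose-1 : ∀ m → choose m 1 ≡ m
choose-1 zero    = refl
choose-1 (suc m) = cong suc (choose-1 m)

choose-absorb : ∀ m k → suc k ℕ.* choose (suc m) (suc k) ≡ suc m ℕ.* choose m k
choose-absorb zero    zero    = refl
choose-absorb zero    (suc k) = ℕP.*-zeroʳ (suc (suc k))
choose-absorb (suc m) zero    = cong (λ t → suc (suc t))
  (trans (cong (ℕ._+ 0) (choose-1 m)) (trans (ℕP.+-identityʳ m) (sym (ℕP.*-identityʳ m))))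
choose-absorb (suc m) (suc k) = begin
  suc (suc k) ℕ.* (x ℕ.+ y)
    ≡⟨ N.solve 3 (λ k x y → (N.con 2 N.:+ k) N.:* (x N.:+ y) N.:=
                            ((N.con 1 N.:+ k) N.:* x) N.:+ x N.:+ ((N.con 2 N.:+ k) N.:* y)) refl k x y ⟩
  suc k ℕ.* x ℕ.+ x ℕ.+ suc (suc k) ℕ.* y
    ≡⟨ cong₂ (λ a b → a ℕ.+ x ℕ.+ b) (choose-absorb m k) (choose-absorb m (suc k)) ⟩
  suc m ℕ.* u ℕ.+ (u ℕ.+ v) ℕ.+ suc m ℕ.* v
    ≡⟨ N.solve 3 (λ m u v → ((N.con 1 N.:+ m) N.:* u) N.:+ (u N.:+ v) N.:+ ((N.con 1 N.:+ m) N.:* v) N.:=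
                            (N.con 2 N.:+ m) N.:* (u N.:+ v)) refl m u v ⟩
  suc (suc m) ℕ.* (u ℕ.+ v) ∎
  where
  open ≡-Reasoning
  module N = NatSolver.+-*-Solver
  x y u v : ℕ
  x = choose (suc m) (suc k)
  y = choose (suc m) (suc (suc k))
  u = choose m k
  v = choose m (suc k)

central : ℕ → ℕ
central k = choose (k ℕ.+ k) k

central-rec : ∀ k → suc k ℕ.* central (suc k) ≡ 2 ℕ.* (suc (k ℕ.+ k) ℕ.* central k)
central-rec k rewrite ℕP.+-suc k k = begin
  suc k ℕ.* (X ℕ.+ Y)          ≡⟨ choose-absorb (suc (k ℕ.+ k)) k ⟩
  suc (suc (k ℕ.+ k)) ℕ.* X    ≡⟨ N.solve 2 (λ k x → (N.con 2 N.:+ k N.:+ k) N.:* x N.:=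
                                                     N.con 2 N.:* ((N.con 1 N.:+ k) N.:* x)) refl k X ⟩
  2 ℕ.* (suc k ℕ.* X)          ≡⟨ cong (2 ℕ.*_) (trans (sym kY≡kX) (choose-absorb (k ℕ.+ k) k)) ⟩
  2 ℕ.* (suc (k ℕ.+ k) ℕ.* central k) ∎
  where
  open ≡-Reasoning
  module N = NatSolver.+-*-Solver
  X Y : ℕ
  X = choose (suc (k ℕ.+ k)) k
  Y = choose (suc (k ℕ.+ k)) (suc k)
  -- symmetry C(2k+1, k+1) = C(2k+1, k), in the form obtained from absorption
  kY≡kX : suc k ℕ.* Y ≡ suc k ℕ.* X
  kY≡kX = ℕP.+-cancelˡ-≡ (suc k ℕ.* X) _ _ (begin
    suc k ℕ.* X ℕ.+ suc k ℕ.* Y  ≡⟨ sym (ℕP.*-distribˡ-+ (suc k) X Y) ⟩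
    suc k ℕ.* (X ℕ.+ Y)          ≡⟨ choose-absorb (suc (k ℕ.+ k)) k ⟩
    suc (suc (k ℕ.+ k)) ℕ.* X    ≡⟨ N.solve 2 (λ k x → (N.con 2 N.:+ k N.:+ k) N.:* x N.:=
                                         (N.con 1 N.:+ k) N.:* x N.:+ (N.con 1 N.:+ k) N.:* x) refl k X ⟩
    suc k ℕ.* X ℕ.+ suc k ℕ.* X  ∎)

choose-absorb-ℚ : ∀ m k → ⟦ suc k ⟧ * ⟦ choose (suc m) (suc k) ⟧ ≡ ⟦ suc m ⟧ * ⟦ choose m k ⟧
choose-absorb-ℚ m k = trans (sym (⟦*⟧ (suc k) (choose (suc m) (suc k))))
                            (trans (cong ⟦_⟧ (choose-absorb m k)) (⟦*⟧ (suc m) (choose m k)))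

central-rec-ℚ : ∀ k → ⟦ suc k ⟧ * ⟦ central (suc k) ⟧ ≡ ⟦ 2 ⟧ * (⟦ suc (k ℕ.+ k) ⟧ * ⟦ central k ⟧)
central-rec-ℚ k = trans (sym (⟦*⟧ (suc k) (central (suc k)))) (trans (cong ⟦_⟧ (central-rec k))
  (trans (⟦*⟧ 2 (suc (k ℕ.+ k) ℕ.* central k)) (cong (⟦ 2 ⟧ *_) (⟦*⟧ (suc (k ℕ.+ k)) (central k)))))

choose-over : ∀ m k → ⟦ choose m k ⟧ * 1/[1+ k ] ≡ ⟦ choose (suc m) (suc k) ⟧ * 1/[1+ m ]
choose-over m k = cross-divide k m ⟦ choose m k ⟧ ⟦ choose (suc m) (suc k) ⟧ (choose-absorb-ℚ m k)

choose-step-ℚ : ∀ m k → ⟦ suc k ⟧ * ⟦ choose m (suc k) ⟧ ≡ (⟦ m ⟧ - ⟦ k ⟧) * ⟦ choose m k ⟧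
choose-step-ℚ m k = begin
  K * b₁                     ≡⟨ solve 3 (λ K b₀ b₁ → K :* b₁ := K :* (b₀ :+ b₁) :- K :* b₀)
                                        refl K b₀ b₁ ⟩
  K * (b₀ + b₁) - K * b₀     ≡⟨ cong (λ t → K * t - K * b₀) (sym (⟦+⟧ (choose m k) (choose m (suc k)))) ⟩
  K * ⟦ choose (suc m) (suc k) ⟧ - K * b₀
                             ≡⟨ cong (_- K * b₀) (choose-absorb-ℚ m k) ⟩
  ⟦ suc m ⟧ * b₀ - K * b₀    ≡⟨ cong₂ (λ u v → u * b₀ - v * b₀) (⟦suc⟧ m) (⟦suc⟧ k) ⟩
  (1ℚ + ⟦ m ⟧) * b₀ - (1ℚ + ⟦ k ⟧) * b₀
                             ≡⟨ solve 3 (λ m k b → (con 1ℚ :+ m) :* b :- (con 1ℚ :+ k) :* b := (m :- k) :* b)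
                                        refl ⟦ m ⟧ ⟦ k ⟧ b₀ ⟩
  (⟦ m ⟧ - ⟦ k ⟧) * b₀       ∎
  where
  open ≡-Reasoning
  K b₀ b₁ : ℚ
  K  = ⟦ suc k ⟧
  b₀ = ⟦ choose m k ⟧
  b₁ = ⟦ choose m (suc k) ⟧

term-as-product : ∀ j → term (suc j) ≡ ⟦ central (suc j) ⟧ * (1/[1+ j ] * 1/[1+ 2 ] ^ suc j)
term-as-product j = begin
  term (suc j)
    ≡⟨ /-by-inverse _ (suc j ℕ.* 3 ℕ.^ suc j) {{ℕP.m*n≢0 (suc j) (3 ℕ.^ suc j) {{_}} {{ℕP.m^n≢0 3 (suc j)}}}}
                    (1/[1+ j ] * 1/[1+ 2 ] ^ suc j) inverse ⟩
  ι (+ ((2 ℕ.* suc j) C suc j)) * (1/[1+ j ] * 1/[1+ 2 ] ^ suc j)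
    ≡⟨ cong (λ t → ⟦ t C suc j ⟧ * (1/[1+ j ] * 1/[1+ 2 ] ^ suc j))
            (cong (suc j ℕ.+_) (ℕP.+-identityʳ (suc j))) ⟩
  ⟦ (suc j ℕ.+ suc j) C suc j ⟧ * (1/[1+ j ] * 1/[1+ 2 ] ^ suc j)
    ≡⟨ cong (λ t → ⟦ t ⟧ * (1/[1+ j ] * 1/[1+ 2 ] ^ suc j)) (sym (choose≡C (suc j ℕ.+ suc j) (suc j))) ⟩
  ⟦ central (suc j) ⟧ * (1/[1+ j ] * 1/[1+ 2 ] ^ suc j) ∎
  where
  open ≡-Reasoning
  inverse : ⟦ suc j ℕ.* 3 ℕ.^ suc j ⟧ * (1/[1+ j ] * 1/[1+ 2 ] ^ suc j) ≡ 1ℚ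
  inverse = begin
    ⟦ suc j ℕ.* 3 ℕ.^ suc j ⟧ * (1/[1+ j ] * 1/[1+ 2 ] ^ suc j)
      ≡⟨ cong (_* (1/[1+ j ] * 1/[1+ 2 ] ^ suc j))
              (trans (⟦*⟧ (suc j) (3 ℕ.^ suc j)) (cong (⟦ suc j ⟧ *_) (⟦^⟧ 3 (suc j)))) ⟩
    (⟦ suc j ⟧ * ⟦ 3 ⟧ ^ suc j) * (1/[1+ j ] * 1/[1+ 2 ] ^ suc j)
      ≡⟨ solve 4 (λ a t r s → (a :* t) :* (r :* s) := (a :* r) :* (t :* s))
                 refl ⟦ suc j ⟧ (⟦ 3 ⟧ ^ suc j) 1/[1+ j ] (1/[1+ 2 ] ^ suc j) ⟩
    (⟦ suc j ⟧ * 1/[1+ j ]) * (⟦ 3 ⟧ ^ suc j * 1/[1+ 2 ] ^ suc j)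
      ≡⟨ cong₂ _*_ (1/[1+]-inverse j) (sym (^-distrib-* ⟦ 3 ⟧ 1/[1+ 2 ] (suc j))) ⟩
    1ℚ * (⟦ 3 ⟧ * 1/[1+ 2 ]) ^ suc j
      ≡⟨ cong (λ t → 1ℚ * t ^ suc j) (1/[1+]-inverse 2) ⟩
    1ℚ * 1ℚ ^ suc j
      ≡⟨ trans (ℚP.*-identityˡ _) (1^n≡1 (suc j)) ⟩
    1ℚ ∎

pascal-sum : ∀ m (f : ℕ → ℚ) →
  sumFrom1 (suc m) (λ k → ⟦ choose (suc m) k ⟧ * f k)
    ≡ sumFrom1 m (λ k → ⟦ choose m k ⟧ * f k) + sumFrom1 (suc m) (λ k → ⟦ choose m (ℕ.pred k) ⟧ * f k)
pascal-sum m f = begin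
  sumFrom1 (suc m) (λ k → ⟦ choose (suc m) k ⟧ * f k)
    ≡⟨ Σ-cong (suc m) (λ k _ → pascal k) ⟩
  sumFrom1 (suc m) (λ k → A k + B k)
    ≡⟨ Σ-+ (suc m) A B ⟩
  sumFrom1 m A + A (suc m) + sumFrom1 (suc m) B
    ≡⟨ cong (λ t → sumFrom1 m A + ⟦ t ⟧ * f (suc m) + sumFrom1 (suc m) B) (choose-zero (ℕP.n<1+n m)) ⟩
  sumFrom1 m A + 0ℚ * f (suc m) + sumFrom1 (suc m) B
    ≡⟨ solve 3 (λ a w b → a :+ con 0ℚ :* w :+ b := a :+ b) refl (sumFrom1 m A) (f (suc m)) (sumFrom1 (suc m) B) ⟩
  sumFrom1 m A + sumFrom1 (suc m) B ∎
  where
  open ≡-Reasoning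
  A B : ℕ → ℚ
  A k = ⟦ choose m k ⟧ * f k
  B k = ⟦ choose m (ℕ.pred k) ⟧ * f k
  pascal : ∀ k → ⟦ choose (suc m) (suc k) ⟧ * f (suc k) ≡ A (suc k) + B (suc k)
  pascal k = trans (cong (_* f (suc k)) (⟦+⟧ (choose m k) (choose m (suc k))))
    (solve 3 (λ a b w → (a :+ b) :* w := b :* w :+ a :* w) refl ⟦ choose m k ⟧ ⟦ choose m (suc k) ⟧ (f (suc k)))

binomial-theorem : ∀ m x → 1ℚ + sumFrom1 m (λ k → ⟦ choose m k ⟧ * x ^ k) ≡ (1ℚ + x) ^ m
binomial-theorem zero    x = refl
binomial-theorem (suc m) x = begin
  1ℚ + sumFrom1 (suc m) (λ k → ⟦ choose (suc m) k ⟧ * x ^ k)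
    ≡⟨ cong (λ t → 1ℚ + t) (pascal-sum m (x ^_)) ⟩
  1ℚ + (S + sumFrom1 (suc m) (λ k → ⟦ choose m (ℕ.pred k) ⟧ * x ^ k))
    ≡⟨ cong (λ t → 1ℚ + (S + t)) lowered ⟩
  1ℚ + (S + x * (1ℚ + S))
    ≡⟨ solve 2 (λ x s → con 1ℚ :+ (s :+ x :* (con 1ℚ :+ s)) := (con 1ℚ :+ x) :* (con 1ℚ :+ s)) refl x S ⟩
  (1ℚ + x) * (1ℚ + S)
    ≡⟨ cong ((1ℚ + x) *_) (binomial-theorem m x) ⟩
  (1ℚ + x) ^ suc m ∎
  where
  open ≡-Reasoning
  S : ℚ
  S = sumFrom1 m (λ k → ⟦ choose m k ⟧ * x ^ k)
  lowered : sumFrom1 (suc m) (λ k → ⟦ choose m (ℕ.pred k) ⟧ * x ^ k) ≡ x * (1ℚ + S)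
  lowered = begin
    sumFrom1 (suc m) (λ k → ⟦ choose m (ℕ.pred k) ⟧ * x ^ k)
      ≡⟨ Σ-shift m _ ⟩
    1ℚ * (x * 1ℚ) + sumFrom1 m (λ k → ⟦ choose m k ⟧ * x ^ suc k)
      ≡⟨ cong (λ t → 1ℚ * (x * 1ℚ) + t) (trans (Σ-cong m (λ k _ → factor-x k)) (Σ-* m x (λ k → ⟦ choose m k ⟧ * x ^ k))) ⟩
    1ℚ * (x * 1ℚ) + x * S
      ≡⟨ solve 2 (λ x s → con 1ℚ :* (x :* con 1ℚ) :+ x :* s := x :* (con 1ℚ :+ s)) refl x S ⟩
    x * (1ℚ + S) ∎
    where
    factor-x : ∀ k → ⟦ choose m (suc k) ⟧ * x ^ suc (suc k) ≡ x * (⟦ choose m (suc k) ⟧ * x ^ suc k)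
    factor-x k = solve 3 (λ a x w → a :* (x :* w) := x :* (a :* w)) refl ⟦ choose m (suc k) ⟧ x (x ^ suc k)

powerOver : ℚ → ℕ → ℚ
powerOver z zero    = 0ℚ
powerOver z (suc j) = z ^ suc j * 1/[1+ j ]

logSum : ℕ → ℚ → ℚ
logSum n z = sumFrom1 n (powerOver z)

binomial-log-identity : ∀ m x →
  sumFrom1 m (λ k → ⟦ choose m k ⟧ * powerOver x k) ≡ logSum m (1ℚ + x) - logSum m 1ℚ
binomial-log-identity zero    x = refl
binomial-log-identity (suc m) x = begin
  sumFrom1 (suc m) (λ k → ⟦ choose (suc m) k ⟧ * powerOver x k)
    ≡⟨ pascal-sum m (powerOver x) ⟩
  S + sumFrom1 (suc m) (λ k → ⟦ choose m (ℕ.pred k) ⟧ * powerOver x k)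
    ≡⟨ cong₂ _+_ (binomial-log-identity m x) lowered ⟩
  (logSum m (1ℚ + x) - logSum m 1ℚ) + ((1ℚ + x) ^ suc m - 1ℚ) * 1/[1+ m ]
    ≡⟨ cong (λ t → (logSum m (1ℚ + x) - logSum m 1ℚ) + ((1ℚ + x) ^ suc m - t) * 1/[1+ m ])
            (sym (1^n≡1 (suc m))) ⟩
  (logSum m (1ℚ + x) - logSum m 1ℚ) + ((1ℚ + x) ^ suc m - 1ℚ ^ suc m) * 1/[1+ m ]
    ≡⟨ solve 5 (λ a b u v r → (a :- b) :+ (u :- v) :* r := (a :+ u :* r) :- (b :+ v :* r))
               refl (logSum m (1ℚ + x)) (logSum m 1ℚ) ((1ℚ + x) ^ suc m) (1ℚ ^ suc m) 1/[1+ m ] ⟩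
  logSum (suc m) (1ℚ + x) - logSum (suc m) 1ℚ ∎
  where
  open ≡-Reasoning
  S : ℚ
  S = sumFrom1 m (λ k → ⟦ choose m k ⟧ * powerOver x k)
  B : ℕ → ℚ
  B k = ⟦ choose (suc m) k ⟧ * x ^ k
  lowered : sumFrom1 (suc m) (λ k → ⟦ choose m (ℕ.pred k) ⟧ * powerOver x k)
            ≡ ((1ℚ + x) ^ suc m - 1ℚ) * 1/[1+ m ]
  lowered = begin
    sumFrom1 (suc m) (λ k → ⟦ choose m (ℕ.pred k) ⟧ * powerOver x k)
      ≡⟨ Σ-cong (suc m) (λ k _ → absorbed k) ⟩
    sumFrom1 (suc m) (λ k → 1/[1+ m ] * B k)
      ≡⟨ Σ-* (suc m) 1/[1+ m ] B ⟩
    1/[1+ m ] * sumFrom1 (suc m) B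
      ≡⟨ cong (1/[1+ m ] *_) (solve 1 (λ s → s := (con 1ℚ :+ s) :- con 1ℚ) refl (sumFrom1 (suc m) B)) ⟩
    1/[1+ m ] * ((1ℚ + sumFrom1 (suc m) B) - 1ℚ)
      ≡⟨ cong (λ t → 1/[1+ m ] * (t - 1ℚ)) (binomial-theorem (suc m) x) ⟩
    1/[1+ m ] * ((1ℚ + x) ^ suc m - 1ℚ)
      ≡⟨ ℚP.*-comm 1/[1+ m ] ((1ℚ + x) ^ suc m - 1ℚ) ⟩
    ((1ℚ + x) ^ suc m - 1ℚ) * 1/[1+ m ] ∎
    where
    absorbed : ∀ k → ⟦ choose m k ⟧ * powerOver x (suc k) ≡ 1/[1+ m ] * B (suc k)
    absorbed k = begin
      ⟦ choose m k ⟧ * (x ^ suc k * 1/[1+ k ])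
        ≡⟨ solve 3 (λ c w r → c :* (w :* r) := (c :* r) :* w) refl ⟦ choose m k ⟧ (x ^ suc k) 1/[1+ k ] ⟩
      (⟦ choose m k ⟧ * 1/[1+ k ]) * x ^ suc k
        ≡⟨ cong (_* x ^ suc k) (choose-over m k) ⟩
      (⟦ choose (suc m) (suc k) ⟧ * 1/[1+ m ]) * x ^ suc k
        ≡⟨ solve 3 (λ c r w → (c :* r) :* w := r :* (c :* w)) refl ⟦ choose (suc m) (suc k) ⟧ 1/[1+ m ] (x ^ suc k) ⟩
      1/[1+ m ] * B (suc k) ∎

-- Formally (1 + √z)^m = E_m(z) + O_m(z)/√z, where E_m(z) = Σ_i C(m,2i) z^i is the even part
-- and O_m(z) = Σ_{i≥1} C(m,2i−1) z^i; multiplying by 1 + √z gives the recursion below.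
mutual
  evenPart : ℚ → ℕ → ℚ
  evenPart z zero    = 1ℚ
  evenPart z (suc m) = evenPart z m + oddPart z m

  oddPart : ℚ → ℕ → ℚ
  oddPart z zero    = 0ℚ
  oddPart z (suc m) = oddPart z m + z * evenPart z m

evenTerm : ℕ → ℚ → ℕ → ℚ
evenTerm m z zero    = 0ℚ
evenTerm m z (suc i) = ⟦ choose m (suc (suc (i ℕ.+ i))) ⟧ * z ^ suc i

oddTerm : ℕ → ℚ → ℕ → ℚ
oddTerm m z zero    = 0ℚ
oddTerm m z (suc i) = ⟦ choose m (suc (i ℕ.+ i)) ⟧ * z ^ suc i

evenSum-step : ∀ N m z →
  1ℚ + sumFrom1 N (evenTerm (suc m) z) ≡ (1ℚ + sumFrom1 N (evenTerm m z)) + sumFrom1 N (oddTerm m z)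
evenSum-step N m z = trans (cong (λ t → 1ℚ + t) (trans (Σ-cong N (λ k _ → pascal k)) (Σ-+ N E O)))
                           (sym (ℚP.+-assoc 1ℚ (sumFrom1 N E) (sumFrom1 N O)))
  where
  E O : ℕ → ℚ
  E = evenTerm m z
  O = oddTerm m z
  pascal : ∀ k → evenTerm (suc m) z (suc k) ≡ evenTerm m z (suc k) + oddTerm m z (suc k)
  pascal k = trans (cong (_* z ^ suc k) (⟦+⟧ (choose m (suc (k ℕ.+ k))) (choose m (suc (suc (k ℕ.+ k))))))
    (solve 3 (λ a b w → (a :+ b) :* w := b :* w :+ a :* w) refl
             ⟦ choose m (suc (k ℕ.+ k)) ⟧ ⟦ choose m (suc (suc (k ℕ.+ k))) ⟧ (z ^ suc k))

-- Pascal's rule for the truncated odd sum:  O_{m+1} = O_m + z E_m, valid while the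
-- truncation at N loses no term of E_m, i.e. while m < 2N.
oddSum-step : ∀ N m z → suc m ℕ.≤ N ℕ.+ N →
  sumFrom1 N (oddTerm (suc m) z) ≡ sumFrom1 N (oddTerm m z) + z * (1ℚ + sumFrom1 N (evenTerm m z))
oddSum-step (suc N) m z m<2N = begin
  sumFrom1 (suc N) (oddTerm (suc m) z)
    ≡⟨ Σ-cong (suc N) (λ k _ → pascal k) ⟩
  sumFrom1 (suc N) (λ k → oddTerm m z k + lower k)
    ≡⟨ Σ-+ (suc N) (oddTerm m z) lower ⟩
  sumFrom1 (suc N) (oddTerm m z) + sumFrom1 (suc N) lower
    ≡⟨ cong (λ t → sumFrom1 (suc N) (oddTerm m z) + t) lowered ⟩
  sumFrom1 (suc N) (oddTerm m z) + z * (1ℚ + sumFrom1 (suc N) (evenTerm m z)) ∎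
  where
  open ≡-Reasoning
  lower : ℕ → ℚ
  lower zero    = 0ℚ
  lower (suc k) = ⟦ choose m (k ℕ.+ k) ⟧ * z ^ suc k
  pascal : ∀ k → oddTerm (suc m) z (suc k) ≡ oddTerm m z (suc k) + lower (suc k)
  pascal k = trans (cong (_* z ^ suc k) (⟦+⟧ (choose m (k ℕ.+ k)) (choose m (suc (k ℕ.+ k)))))
    (solve 3 (λ a b w → (a :+ b) :* w := b :* w :+ a :* w) refl
             ⟦ choose m (k ℕ.+ k) ⟧ ⟦ choose m (suc (k ℕ.+ k)) ⟧ (z ^ suc k))
  shifted : ∀ i → lower (suc (suc i)) ≡ z * evenTerm m z (suc i)
  shifted i = trans (cong (λ t → ⟦ choose m t ⟧ * z ^ suc (suc i)) (ℕP.+-suc (suc i) i))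
    (solve 3 (λ a z w → a :* (z :* w) := z :* (a :* w)) refl ⟦ choose m (suc (suc (i ℕ.+ i))) ⟧ z (z ^ suc i))
  top-vanishes : evenTerm m z (suc N) ≡ 0ℚ
  top-vanishes = trans (cong (λ t → ⟦ t ⟧ * z ^ suc N)
                             (choose-zero (subst (suc m ℕ.≤_) (cong suc (ℕP.+-suc N N)) m<2N)))
                       (ℚP.*-zeroˡ (z ^ suc N))
  lowered : sumFrom1 (suc N) lower ≡ z * (1ℚ + sumFrom1 (suc N) (evenTerm m z))
  lowered = begin
    sumFrom1 (suc N) lower
      ≡⟨ Σ-shift N lower ⟩
    lower 1 + sumFrom1 N (λ k → lower (suc k))
      ≡⟨ cong (λ t → lower 1 + t) (trans (Σ-cong N (λ k _ → shifted k)) (Σ-* N z (evenTerm m z))) ⟩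
    1ℚ * (z * 1ℚ) + z * sumFrom1 N (evenTerm m z)
      ≡⟨ solve 2 (λ z s → con 1ℚ :* (z :* con 1ℚ) :+ z :* s := z :* (con 1ℚ :+ (s :+ con 0ℚ))) refl
               z (sumFrom1 N (evenTerm m z)) ⟩
    z * (1ℚ + (sumFrom1 N (evenTerm m z) + 0ℚ))
      ≡⟨ cong (λ t → z * (1ℚ + (sumFrom1 N (evenTerm m z) + t))) (sym top-vanishes) ⟩
    z * (1ℚ + sumFrom1 (suc N) (evenTerm m z)) ∎

parts-as-sums : ∀ N m z → m ℕ.≤ N ℕ.+ N →
  1ℚ + sumFrom1 N (evenTerm m z) ≡ evenPart z m × sumFrom1 N (oddTerm m z) ≡ oddPart z m
parts-as-sums N zero    z _ =
  trans (cong (λ t → 1ℚ + t) (Σ-zero N (λ k _ → ℚP.*-zeroˡ (z ^ suc k)))) (ℚP.+-identityʳ 1ℚ) ,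
  Σ-zero N (λ k _ → ℚP.*-zeroˡ (z ^ suc k))
parts-as-sums N (suc m) z m<2N with parts-as-sums N m z (ℕP.<⇒≤ m<2N)
... | even≡ , odd≡ =
  trans (evenSum-step N m z) (cong₂ _+_ even≡ odd≡) ,
  trans (oddSum-step N m z m<2N) (cong₂ (λ u v → u + z * v) odd≡ even≡)

evenPart-as-sum : ∀ N z → 1ℚ + sumFrom1 N (evenTerm (suc (N ℕ.+ N)) z) ≡ evenPart z (suc (N ℕ.+ N))
evenPart-as-sum N z with parts-as-sums N (N ℕ.+ N) z ℕP.≤-refl
... | even≡ , odd≡ =
  trans (evenSum-step N (N ℕ.+ N) z) (cong₂ _+_ even≡ odd≡)

parts-at-one : ∀ m → evenPart 1ℚ (suc m) ≡ ⟦ 2 ⟧ ^ m × oddPart 1ℚ (suc m) ≡ ⟦ 2 ⟧ ^ m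
parts-at-one zero    = refl , refl
parts-at-one (suc m) with parts-at-one m
... | even≡ , odd≡ =
  trans (cong₂ _+_ even≡ odd≡) (solve 1 (λ t → t :+ t := con ⟦ 2 ⟧ :* t) refl (⟦ 2 ⟧ ^ m)) ,
  trans (cong₂ (λ u v → u + 1ℚ * v) odd≡ even≡)
        (solve 1 (λ t → t :+ con 1ℚ :* t := con ⟦ 2 ⟧ :* t) refl (⟦ 2 ⟧ ^ m))

evenPart-one : ∀ n → evenPart 1ℚ (suc (n ℕ.+ n)) ≡ ⟦ 4 ⟧ ^ n
evenPart-one n = begin
  evenPart 1ℚ (suc (n ℕ.+ n))  ≡⟨ proj₁ (parts-at-one (n ℕ.+ n)) ⟩
  ⟦ 2 ⟧ ^ (n ℕ.+ n)            ≡⟨ ^-homo-* ⟦ 2 ⟧ n n ⟩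
  ⟦ 2 ⟧ ^ n * ⟦ 2 ⟧ ^ n        ≡⟨ sym (^-distrib-* ⟦ 2 ⟧ ⟦ 2 ⟧ n) ⟩
  ⟦ 4 ⟧ ^ n                    ∎
  where open ≡-Reasoning

-- ζ = −1/3.  Since 1 + √ζ = (2/√3)·e^{iπ/6}, we have (1 + √ζ)^6 = −64/27, so the even
-- part at ζ is periodic of period 6 up to this factor.
ζ : ℚ
ζ = - 1/[1+ 2 ]

evenPart-ζ-period : ∀ m → evenPart ζ (6 ℕ.+ m) ≡ (- ⟦ 64 ⟧ * 1/[1+ 26 ]) * evenPart ζ m
evenPart-ζ-period m =
  solve 2 (λ e o → let e₁ = e :+ o ; o₁ = o :+ con ζ :* e
                       e₂ = e₁ :+ o₁ ; o₂ = o₁ :+ con ζ :* e₁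
                       e₃ = e₂ :+ o₂ ; o₃ = o₂ :+ con ζ :* e₂
                       e₄ = e₃ :+ o₃ ; o₄ = o₃ :+ con ζ :* e₃
                       e₅ = e₄ :+ o₄ ; o₅ = o₄ :+ con ζ :* e₄
                   in e₅ :+ o₅ := con (- ⟦ 64 ⟧ * 1/[1+ 26 ]) :* e)
          refl (evenPart ζ m) (oddPart ζ m)

odd+6 : ∀ n → suc (suc (suc (suc n)) ℕ.+ suc (suc (suc n))) ≡ 6 ℕ.+ suc (n ℕ.+ n)
odd+6 n = N.solve 1 (λ n → N.con 4 N.:+ n N.:+ (N.con 3 N.:+ n) N.:= N.con 7 N.:+ (n N.:+ n)) refl n
  where module N = NatSolver.+-*-Solver

Sign : ℚ → Set
Sign ε = ε ≡ 1ℚ ⊎ ε ≡ - 1ℚ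

Sign-square : ∀ {ε} → Sign ε → ε * ε ≡ 1ℚ
Sign-square (inj₁ refl) = refl
Sign-square (inj₂ refl) = refl

-- 3^n E_{2n+1}(ζ) = ±4^n unless 3 divides 2n+1 (the only case where cos((2n+1)π/6) vanishes).
evenPart-ζ : ∀ n → 3 ∣ suc (n ℕ.+ n) ⊎
  Σ ℚ (λ ε → Sign ε × ⟦ 3 ⟧ ^ n * evenPart ζ (suc (n ℕ.+ n)) ≡ ε * ⟦ 4 ⟧ ^ n)
evenPart-ζ 0 = inj₂ (1ℚ , inj₁ refl , refl)
evenPart-ζ 1 = inj₁ (divides 1 refl)
evenPart-ζ 2 = inj₂ (- 1ℚ , inj₂ refl , refl)
evenPart-ζ (suc (suc (suc n))) with evenPart-ζ n
... | inj₁ 3∣2n+1 = inj₁ (subst (3 ∣_) (sym (odd+6 n)) (ℕD.∣m∣n⇒∣m+n (divides 2 refl) 3∣2n+1))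
... | inj₂ (ε , ε-sign , eq) = inj₂ (- ε , flip ε-sign , (begin
  ⟦ 3 ⟧ * (⟦ 3 ⟧ * (⟦ 3 ⟧ * c)) * evenPart ζ (suc (suc (suc (suc n)) ℕ.+ suc (suc (suc n))))
    ≡⟨ cong (λ m → ⟦ 3 ⟧ * (⟦ 3 ⟧ * (⟦ 3 ⟧ * c)) * evenPart ζ m) (odd+6 n) ⟩
  ⟦ 3 ⟧ * (⟦ 3 ⟧ * (⟦ 3 ⟧ * c)) * evenPart ζ (6 ℕ.+ suc (n ℕ.+ n))
    ≡⟨ cong (⟦ 3 ⟧ * (⟦ 3 ⟧ * (⟦ 3 ⟧ * c)) *_) (evenPart-ζ-period (suc (n ℕ.+ n))) ⟩
  ⟦ 3 ⟧ * (⟦ 3 ⟧ * (⟦ 3 ⟧ * c)) * ((- ⟦ 64 ⟧ * 1/[1+ 26 ]) * e)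
    ≡⟨ solve 2 (λ c e → con ⟦ 3 ⟧ :* (con ⟦ 3 ⟧ :* (con ⟦ 3 ⟧ :* c)) :* ((:- con ⟦ 64 ⟧ :* con 1/[1+ 26 ]) :* e)
                        := :- con ⟦ 64 ⟧ :* (c :* e)) refl c e ⟩
  - ⟦ 64 ⟧ * (c * e)
    ≡⟨ cong (- ⟦ 64 ⟧ *_) eq ⟩
  - ⟦ 64 ⟧ * (ε * f)
    ≡⟨ solve 2 (λ ε f → :- con ⟦ 64 ⟧ :* (ε :* f) := :- ε :* (con ⟦ 4 ⟧ :* (con ⟦ 4 ⟧ :* (con ⟦ 4 ⟧ :* f))))
               refl ε f ⟩
  - ε * (⟦ 4 ⟧ * (⟦ 4 ⟧ * (⟦ 4 ⟧ * f))) ∎))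
  where
  open ≡-Reasoning
  c e f : ℚ
  c = ⟦ 3 ⟧ ^ n
  e = evenPart ζ (suc (n ℕ.+ n))
  f = ⟦ 4 ⟧ ^ n
  flip : Sign ε → Sign (- ε)
  flip (inj₁ refl) = inj₂ refl
  flip (inj₂ refl) = inj₁ refl

-- The algebraic heart of the last step.  If c(1 + P b) = ε(1 + P a) with ε² = 1 and
-- P r = 1, then c = ε + P d for d = εa − bc, and
--   (2a − 2b) − (c² − 1) r = P (2εbd − d²).
fermat-quotient-identity : ∀ P r ε a b c → P * r ≡ 1ℚ → ε * ε ≡ 1ℚ →
  c * (1ℚ + P * b) ≡ ε * (1ℚ + P * a) →
  let d = ε * a - b * c in
  (⟦ 2 ⟧ * a - ⟦ 2 ⟧ * b) - (c * c - 1ℚ) * r ≡ P * (⟦ 2 ⟧ * ε * b * d - d * d)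
fermat-quotient-identity P r ε a b c Pr≡1 ε²≡1 norm≡ = begin
  (⟦ 2 ⟧ * a - ⟦ 2 ⟧ * b) - (c * c - 1ℚ) * r
    ≡⟨ cong (λ t → (⟦ 2 ⟧ * a - ⟦ 2 ⟧ * b) - t) quotient≡ ⟩
  (⟦ 2 ⟧ * a - ⟦ 2 ⟧ * b) - (⟦ 2 ⟧ * ε * d + P * d * d)
    ≡⟨ cong (λ t → (⟦ 2 ⟧ * a - ⟦ 2 ⟧ * b) - (t + P * d * d)) linear≡ ⟩
  (⟦ 2 ⟧ * a - ⟦ 2 ⟧ * b) - ((⟦ 2 ⟧ * a - ⟦ 2 ⟧ * b - ⟦ 2 ⟧ * ε * b * P * d) + P * d * d)
    ≡⟨ solve 5 (λ a b ε P d → (con ⟦ 2 ⟧ :* a :- con ⟦ 2 ⟧ :* b)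
                 :- ((con ⟦ 2 ⟧ :* a :- con ⟦ 2 ⟧ :* b :- con ⟦ 2 ⟧ :* ε :* b :* P :* d) :+ P :* d :* d)
               := P :* (con ⟦ 2 ⟧ :* ε :* b :* d :- d :* d)) refl a b ε P d ⟩
  P * (⟦ 2 ⟧ * ε * b * d - d * d) ∎
  where
  open ≡-Reasoning
  d : ℚ
  d = ε * a - b * c
  c≡ε+Pd : c ≡ ε + P * d
  c≡ε+Pd = begin
    c                             ≡⟨ solve 3 (λ c P b → c := c :* (con 1ℚ :+ P :* b) :- P :* b :* c) refl c P b ⟩
    c * (1ℚ + P * b) - P * b * c  ≡⟨ cong (λ t → t - P * b * c) norm≡ ⟩
    ε * (1ℚ + P * a) - P * b * c  ≡⟨ solve 5 (λ ε P a b c → ε :* (con 1ℚ :+ P :* a) :- P :* b :* c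
                                                          := ε :+ P :* (ε :* a :- b :* c)) refl ε P a b c ⟩
    ε + P * d                     ∎
  quotient≡ : (c * c - 1ℚ) * r ≡ ⟦ 2 ⟧ * ε * d + P * d * d
  quotient≡ = begin
    (c * c - 1ℚ) * r
      ≡⟨ cong (λ t → (t * t - 1ℚ) * r) c≡ε+Pd ⟩
    ((ε + P * d) * (ε + P * d) - 1ℚ) * r
      ≡⟨ solve 4 (λ ε P d r → ((ε :+ P :* d) :* (ε :+ P :* d) :- con 1ℚ) :* r
                   := (ε :* ε :- con 1ℚ) :* r :+ (P :* r) :* (con ⟦ 2 ⟧ :* ε :* d :+ P :* d :* d)) refl ε P d r ⟩
    (ε * ε - 1ℚ) * r + (P * r) * (⟦ 2 ⟧ * ε * d + P * d * d)
      ≡⟨ cong₂ (λ u v → (u - 1ℚ) * r + v * (⟦ 2 ⟧ * ε * d + P * d * d)) ε²≡1 Pr≡1 ⟩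
    (1ℚ - 1ℚ) * r + 1ℚ * (⟦ 2 ⟧ * ε * d + P * d * d)
      ≡⟨ solve 2 (λ r t → (con 1ℚ :- con 1ℚ) :* r :+ con 1ℚ :* t := t) refl r (⟦ 2 ⟧ * ε * d + P * d * d) ⟩
    ⟦ 2 ⟧ * ε * d + P * d * d ∎
  linear≡ : ⟦ 2 ⟧ * ε * d ≡ ⟦ 2 ⟧ * a - ⟦ 2 ⟧ * b - ⟦ 2 ⟧ * ε * b * P * d
  linear≡ = begin
    ⟦ 2 ⟧ * ε * (ε * a - b * c)
      ≡⟨ solve 4 (λ ε a b c → con ⟦ 2 ⟧ :* ε :* (ε :* a :- b :* c)
                   := con ⟦ 2 ⟧ :* (ε :* ε) :* a :- con ⟦ 2 ⟧ :* b :* (ε :* c)) refl ε a b c ⟩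
    ⟦ 2 ⟧ * (ε * ε) * a - ⟦ 2 ⟧ * b * (ε * c)
      ≡⟨ cong₂ (λ u v → ⟦ 2 ⟧ * u * a - ⟦ 2 ⟧ * b * (ε * v)) ε²≡1 c≡ε+Pd ⟩
    ⟦ 2 ⟧ * 1ℚ * a - ⟦ 2 ⟧ * b * (ε * (ε + P * d))
      ≡⟨ solve 5 (λ ε a b P d → con ⟦ 2 ⟧ :* con 1ℚ :* a :- con ⟦ 2 ⟧ :* b :* (ε :* (ε :+ P :* d))
                   := con ⟦ 2 ⟧ :* a :- con ⟦ 2 ⟧ :* b :* (ε :* ε) :- con ⟦ 2 ⟧ :* ε :* b :* P :* d)
                 refl ε a b P d ⟩
    ⟦ 2 ⟧ * a - ⟦ 2 ⟧ * b * (ε * ε) - ⟦ 2 ⟧ * ε * b * P * d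
      ≡⟨ cong (λ u → ⟦ 2 ⟧ * a - ⟦ 2 ⟧ * b * u - ⟦ 2 ⟧ * ε * b * P * d) ε²≡1 ⟩
    ⟦ 2 ⟧ * a - ⟦ 2 ⟧ * b * 1ℚ - ⟦ 2 ⟧ * ε * b * P * d
      ≡⟨ cong (λ u → ⟦ 2 ⟧ * a - u - ⟦ 2 ⟧ * ε * b * P * d) (ℚP.*-identityʳ (⟦ 2 ⟧ * b)) ⟩
    ⟦ 2 ⟧ * a - ⟦ 2 ⟧ * b - ⟦ 2 ⟧ * ε * b * P * d ∎

module ModPrime (p : ℕ) (p-prime : Prime p) where

  P : ℚ
  P = ⟦ p ⟧

  ¬p∣small : ∀ k → suc k ℕ.< p → ¬ p ∣ suc k
  ¬p∣small k k+1<p p∣k+1 = ℕP.<⇒≱ k+1<p (ℕD.∣⇒≤ p∣k+1)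

  ¬p∣1 : ¬ p ∣ 1
  ¬p∣1 = ¬p∣small 0 (ℕ.nonTrivial⇒n>1 p {{prime⇒nonTrivial p-prime}})

  ¬p∣* : ∀ {a b} → ¬ p ∣ a → ¬ p ∣ b → ¬ p ∣ a ℕ.* b
  ¬p∣* {a} {b} p∤a p∤b p∣ab = [ p∤a , p∤b ]′ (euclidsLemma a b p-prime p∣ab)

  -- p-integral rationals form a ring: reduction only shrinks the denominator.
  integral-/ : ∀ i m .{{_ : NonZero m}} → ¬ p ∣ m → pIntegral p (i / m)
  integral-/ i m p∤m p∣den = p∤m (ℕD.∣-trans p∣den (divides ℤ.∣ gcd i (+ m) ∣ m≡))
    where
    m≡ : m ≡ ℤ.∣ gcd i (+ m) ∣ ℕ.* ↧ₙ (i / m)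
    m≡ = trans (sym (cong ℤ.∣_∣ (ℚP.↧-/ i m)))
               (trans (ℤP.∣i*j∣≡∣i∣*∣j∣ (↧ (i / m)) (gcd i (+ m))) (ℕP.*-comm (↧ₙ (i / m)) _))

  integral-+ : ∀ x y → pIntegral p x → pIntegral p y → pIntegral p (x + y)
  integral-+ x@record{} y@record{} x∈ y∈ =
    integral-/ (↥ x ℤ.* ↧ y ℤ.+ ↥ y ℤ.* ↧ x) (↧ₙ x ℕ.* ↧ₙ y) (¬p∣* x∈ y∈)

  integral-* : ∀ x y → pIntegral p x → pIntegral p y → pIntegral p (x * y)
  integral-* x@record{} y@record{} x∈ y∈ = integral-/ (↥ x ℤ.* ↥ y) (↧ₙ x ℕ.* ↧ₙ y) (¬p∣* x∈ y∈)

  integral-neg : ∀ x → pIntegral p x → pIntegral p (- x)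
  integral-neg x x∈ = subst (λ v → ¬ p ∣ v) (sym (cong ℤ.∣_∣ (ℚP.↧-neg x))) x∈

  integral-- : ∀ x y → pIntegral p x → pIntegral p y → pIntegral p (x - y)
  integral-- x y x∈ y∈ = integral-+ x (- y) x∈ (integral-neg y y∈)

  integral-⟦⟧ : ∀ k → pIntegral p ⟦ k ⟧
  integral-⟦⟧ k = ¬p∣1

  integral-1/[1+] : ∀ k → suc k ℕ.< p → pIntegral p 1/[1+ k ]
  integral-1/[1+] = ¬p∣small

  integral-^ : ∀ x k → pIntegral p x → pIntegral p (x ^ k)
  integral-^ x zero    x∈ = ¬p∣1
  integral-^ x (suc k) x∈ = integral-* x (x ^ k) x∈ (integral-^ x k x∈)

  integral-Σ : ∀ N (f : ℕ → ℚ) → (∀ k → k ℕ.< N → pIntegral p (f (suc k))) → pIntegral p (sumFrom1 N f)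
  integral-Σ zero    f f∈ = ¬p∣1
  integral-Σ (suc N) f f∈ = integral-+ (sumFrom1 N f) (f (suc N))
    (integral-Σ N f (λ k k<N → f∈ k (ℕP.m<n⇒m<1+n k<N))) (f∈ N (ℕP.n<1+n N))

  infix 4 _≈_
  record _≈_ (x y : ℚ) : Set where
    constructor ≈-by
    field
      quot     : ℚ
      integral : pIntegral p quot
      diff     : x - y ≡ P * quot

  ≈-byP : ∀ {x y} t → pIntegral p t → x ≡ y + P * t → x ≈ y
  ≈-byP {x} {y} t t∈ x≡ = ≈-by t t∈
    (trans (cong (_- y) x≡) (solve 3 (λ y P t → (y :+ P :* t) :- y := P :* t) refl y P t))

  ≈-refl : ∀ {x} → x ≈ x
  ≈-refl {x} = ≈-byP 0ℚ ¬p∣1 (solve 2 (λ x P → x := x :+ P :* con 0ℚ) refl x P)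

  ≈-reflexive : ∀ {x y} → x ≡ y → x ≈ y
  ≈-reflexive refl = ≈-refl

  ≈-sym : ∀ {x y} → x ≈ y → y ≈ x
  ≈-sym {x} {y} (≈-by t t∈ x-y≡) = ≈-by (- t) (integral-neg t t∈) (begin
    y - x      ≡⟨ solve 2 (λ x y → y :- x := :- (x :- y)) refl x y ⟩
    - (x - y)  ≡⟨ cong -_ x-y≡ ⟩
    - (P * t)  ≡⟨ solve 2 (λ P t → :- (P :* t) := P :* (:- t)) refl P t ⟩
    P * - t    ∎)
    where open ≡-Reasoning

  ≈-trans : ∀ {x y w} → x ≈ y → y ≈ w → x ≈ w
  ≈-trans {x} {y} {w} (≈-by t t∈ x-y≡) (≈-by s s∈ y-w≡) = ≈-by (t + s) (integral-+ t s t∈ s∈) (begin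
    x - w              ≡⟨ solve 3 (λ x y w → x :- w := (x :- y) :+ (y :- w)) refl x y w ⟩
    (x - y) + (y - w)  ≡⟨ cong₂ _+_ x-y≡ y-w≡ ⟩
    P * t + P * s      ≡⟨ sym (ℚP.*-distribˡ-+ P t s) ⟩
    P * (t + s)        ∎)
    where open ≡-Reasoning

  ≈-+ : ∀ {x y u v} → x ≈ y → u ≈ v → x + u ≈ y + v
  ≈-+ {x} {y} {u} {v} (≈-by t t∈ x-y≡) (≈-by s s∈ u-v≡) = ≈-by (t + s) (integral-+ t s t∈ s∈) (begin
    (x + u) - (y + v)  ≡⟨ solve 4 (λ x y u v → (x :+ u) :- (y :+ v) := (x :- y) :+ (u :- v)) refl x y u v ⟩
    (x - y) + (u - v)  ≡⟨ cong₂ _+_ x-y≡ u-v≡ ⟩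
    P * t + P * s      ≡⟨ sym (ℚP.*-distribˡ-+ P t s) ⟩
    P * (t + s)        ∎)
    where open ≡-Reasoning

  ≈-neg : ∀ {x y} → x ≈ y → - x ≈ - y
  ≈-neg {x} {y} (≈-by t t∈ x-y≡) = ≈-by (- t) (integral-neg t t∈) (begin
    - x - - y  ≡⟨ solve 2 (λ x y → :- x :- :- y := :- (x :- y)) refl x y ⟩
    - (x - y)  ≡⟨ cong -_ x-y≡ ⟩
    - (P * t)  ≡⟨ solve 2 (λ P t → :- (P :* t) := P :* (:- t)) refl P t ⟩
    P * - t    ∎)
    where open ≡-Reasoning

  ≈-*ˡ : ∀ c {x y} → pIntegral p c → x ≈ y → c * x ≈ c * y
  ≈-*ˡ c {x} {y} c∈ (≈-by t t∈ x-y≡) = ≈-by (c * t) (integral-* c t c∈ t∈) (begin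
    c * x - c * y  ≡⟨ solve 3 (λ c x y → c :* x :- c :* y := c :* (x :- y)) refl c x y ⟩
    c * (x - y)    ≡⟨ cong (c *_) x-y≡ ⟩
    c * (P * t)    ≡⟨ solve 3 (λ c P t → c :* (P :* t) := P :* (c :* t)) refl c P t ⟩
    P * (c * t)    ∎)
    where open ≡-Reasoning

  ≈-*ʳ : ∀ c {x y} → pIntegral p c → x ≈ y → x * c ≈ y * c
  ≈-*ʳ c {x} {y} c∈ x≈y =
    ≈-trans (≈-reflexive (ℚP.*-comm x c)) (≈-trans (≈-*ˡ c c∈ x≈y) (≈-reflexive (ℚP.*-comm c y)))

  ≈-*ℕ : ∀ k {x y} → x ≈ y → ⟦ k ⟧ * x ≈ ⟦ k ⟧ * y
  ≈-*ℕ k = ≈-*ˡ ⟦ k ⟧ (integral-⟦⟧ k)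

  ≈-cancel : ∀ m {x y} → suc m ℕ.< p → ⟦ suc m ⟧ * x ≈ ⟦ suc m ⟧ * y → x ≈ y
  ≈-cancel m {x} {y} m+1<p mx≈my =
    ≈-trans (≈-reflexive (sym (1/[1+]-cancel m x)))
            (≈-trans (≈-*ˡ 1/[1+ m ] (integral-1/[1+] m m+1<p) mx≈my) (≈-reflexive (1/[1+]-cancel m y)))

  Σ-≈ : ∀ N {f g : ℕ → ℚ} → (∀ k → k ℕ.< N → f (suc k) ≈ g (suc k)) → sumFrom1 N f ≈ sumFrom1 N g
  Σ-≈ zero    f≈g = ≈-refl
  Σ-≈ (suc N) f≈g = ≈-+ (Σ-≈ N (λ k k<N → f≈g k (ℕP.m<n⇒m<1+n k<N))) (f≈g N (ℕP.n<1+n N))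

  ≈-setoid : Setoid 0ℓ 0ℓ
  ≈-setoid = record { _≈_ = _≈_ ; isEquivalence = record { refl = ≈-refl ; sym = ≈-sym ; trans = ≈-trans } }

  module ≈-Reasoning = SetoidReasoning ≈-setoid

  ≈-integral : ∀ {x y} → x ≈ y → pIntegral p y → pIntegral p x
  ≈-integral {x} {y} (≈-by t t∈ x-y≡) y∈ =
    subst (pIntegral p) (trans (cong (λ u → y + u) (sym x-y≡)) (solve 2 (λ x y → y :+ (x :- y) := x) refl x y))
          (integral-+ y (P * t) y∈ (integral-* P t ¬p∣1 t∈))

  integral-sign : ∀ {ε} → Sign ε → pIntegral p ε
  integral-sign (inj₁ refl) = ¬p∣1
  integral-sign (inj₂ refl) = ¬p∣1

  -- p divides the reduced numerator of p t for p-integral t: the cancelled gcd divides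
  -- the denominator of t, hence is prime to p.
  numerator-divisible : ∀ t → pIntegral p t → p ∣ ℤ.∣ ↥ (P * t) ∣
  numerator-divisible t@record{} t∈ =
    [ (λ p∣num → p∣num) , (λ p∣g → contradiction (ℕD.∣-trans p∣g g∣den) t∈) ]′
      (euclidsLemma _ g p-prime (divides ℤ.∣ ↥ t ∣ (trans num*g≡ (ℕP.*-comm p ℤ.∣ ↥ t ∣))))
    where
    i : ℤ
    i = + p ℤ.* ↥ t
    m g : ℕ
    m = 1 ℕ.* ↧ₙ t
    g = NatGCD.gcd ℤ.∣ i ∣ m
    num*g≡ : ℤ.∣ ↥ (i / m) ∣ ℕ.* g ≡ p ℕ.* ℤ.∣ ↥ t ∣
    num*g≡ = trans (sym (ℤP.∣i*j∣≡∣i∣*∣j∣ (↥ (i / m)) (gcd i (+ m))))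
                   (trans (cong ℤ.∣_∣ (ℚP.↥-/ i m)) (ℤP.∣i*j∣≡∣i∣*∣j∣ (+ p) (↥ t)))
    g∣den : g ∣ ↧ₙ t
    g∣den = subst (g ∣_) (ℕP.+-identityʳ (↧ₙ t)) (NatGCD.gcd[m,n]∣n ℤ.∣ i ∣ m)

  ≈⇒≡[modℚ] : ∀ {x y} → x ≈ y → pIntegral p y → x ≡ y [modℚ p ]
  ≈⇒≡[modℚ] {x} {y} x≈y@(≈-by t t∈ x-y≡) y∈ =
    ≈-integral x≈y y∈ , y∈ , subst (λ u → p ∣ ℤ.∣ ↥ u ∣) (sym x-y≡) (numerator-divisible t t∈)

module OddPrime (n : ℕ) (p-prime : Prime (suc (n ℕ.+ n))) (p>3 : 3 ℕ.< suc (n ℕ.+ n)) where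

  p : ℕ
  p = suc (n ℕ.+ n)

  open ModPrime p p-prime

  suc<p : ∀ i → i ℕ.< n → suc i ℕ.< p
  suc<p i i<n = ℕ.s≤s (ℕP.≤-trans i<n (ℕP.m≤m+n n n))

  -- C(p, k) ≡ 0 for 0 < k < p, since k C(p,k) = p C(p−1, k−1).
  choose-p≈0 : ∀ k → suc k ℕ.< p → ⟦ choose p (suc k) ⟧ ≈ 0ℚ
  choose-p≈0 k k+1<p = ≈-cancel k k+1<p (≈-byP b (integral-⟦⟧ (choose (n ℕ.+ n) k)) (begin
    ⟦ suc k ⟧ * ⟦ choose p (suc k) ⟧  ≡⟨ choose-absorb-ℚ (n ℕ.+ n) k ⟩
    P * b                             ≡⟨ solve 3 (λ K P b → P :* b := K :* con 0ℚ :+ P :* b) refl ⟦ suc k ⟧ P b ⟩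
    ⟦ suc k ⟧ * 0ℚ + P * b            ∎))
    where
    open ≡-Reasoning
    b : ℚ
    b = ⟦ choose (n ℕ.+ n) k ⟧

  choose-2n : ∀ k → k ℕ.≤ n ℕ.+ n → ⟦ choose (n ℕ.+ n) k ⟧ ≈ (- 1ℚ) ^ k
  choose-2n zero    _ = ≈-refl
  choose-2n (suc k) k<2n = begin
    ⟦ choose (n ℕ.+ n) (suc k) ⟧
      ≡⟨ solve 2 (λ a b → b := (a :+ b) :- a) refl ⟦ choose (n ℕ.+ n) k ⟧ ⟦ choose (n ℕ.+ n) (suc k) ⟧ ⟩
    (⟦ choose (n ℕ.+ n) k ⟧ + ⟦ choose (n ℕ.+ n) (suc k) ⟧) - ⟦ choose (n ℕ.+ n) k ⟧
      ≡⟨ cong (_- ⟦ choose (n ℕ.+ n) k ⟧) (sym (⟦+⟧ (choose (n ℕ.+ n) k) (choose (n ℕ.+ n) (suc k)))) ⟩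
    ⟦ choose p (suc k) ⟧ - ⟦ choose (n ℕ.+ n) k ⟧
      ≈⟨ ≈-+ (choose-p≈0 k (ℕ.s≤s k<2n)) (≈-neg (choose-2n k (ℕP.<⇒≤ k<2n))) ⟩
    0ℚ - (- 1ℚ) ^ k
      ≡⟨ solve 1 (λ w → con 0ℚ :- w := (:- con 1ℚ) :* w) refl ((- 1ℚ) ^ k) ⟩
    (- 1ℚ) ^ suc k ∎
    where open ≈-Reasoning

  -- The exact identity behind the next lemma, with B = C(n,k) and W = (−4)^k:
  --   2(2k+1) B W = (k+1) C(n,k+1) (−4)^{k+1} + p·2BW,
  -- from (k+1) C(n,k+1) = (n−k) C(n,k) and 2(2k+1) = −4(n−k) + 2p.
  central-low-step : ∀ k → let B = ⟦ choose n k ⟧ ; W = (- ⟦ 4 ⟧) ^ k in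
    ⟦ 2 ⟧ * (⟦ suc (k ℕ.+ k) ⟧ * (B * W))
      ≡ ⟦ suc k ⟧ * (⟦ choose n (suc k) ⟧ * (- ⟦ 4 ⟧ * W)) + P * (⟦ 2 ⟧ * B * W)
  central-low-step k = sym (begin
    ⟦ suc k ⟧ * (B′ * (- ⟦ 4 ⟧ * W)) + P * (⟦ 2 ⟧ * B * W)
      ≡⟨ solve 5 (λ K B′ W P B → K :* (B′ :* (:- con ⟦ 4 ⟧ :* W)) :+ P :* (con ⟦ 2 ⟧ :* B :* W)
                                 := (K :* B′) :* (:- con ⟦ 4 ⟧) :* W :+ P :* (con ⟦ 2 ⟧ :* B :* W))
                 refl ⟦ suc k ⟧ B′ W P B ⟩
    (⟦ suc k ⟧ * B′) * (- ⟦ 4 ⟧) * W + P * (⟦ 2 ⟧ * B * W)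
      ≡⟨ cong₂ (λ u v → u * (- ⟦ 4 ⟧) * W + v * (⟦ 2 ⟧ * B * W)) (choose-step-ℚ n k) (⟦1+2k⟧ n) ⟩
    ((⟦ n ⟧ - ⟦ k ⟧) * B) * (- ⟦ 4 ⟧) * W + (1ℚ + ⟦ n ⟧ + ⟦ n ⟧) * (⟦ 2 ⟧ * B * W)
      ≡⟨ solve 4 (λ n k B W → ((n :- k) :* B) :* (:- con ⟦ 4 ⟧) :* W
                                 :+ (con 1ℚ :+ n :+ n) :* (con ⟦ 2 ⟧ :* B :* W)
                              := con ⟦ 2 ⟧ :* ((con 1ℚ :+ k :+ k) :* (B :* W)))
                 refl ⟦ n ⟧ ⟦ k ⟧ B W ⟩
    ⟦ 2 ⟧ * ((1ℚ + ⟦ k ⟧ + ⟦ k ⟧) * (B * W))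
      ≡⟨ cong (λ t → ⟦ 2 ⟧ * (t * (B * W))) (sym (⟦1+2k⟧ k)) ⟩
    ⟦ 2 ⟧ * (⟦ suc (k ℕ.+ k) ⟧ * (B * W)) ∎)
    where
    open ≡-Reasoning
    B B′ W : ℚ
    B  = ⟦ choose n k ⟧
    B′ = ⟦ choose n (suc k) ⟧
    W  = (- ⟦ 4 ⟧) ^ k

  central-low : ∀ k → k ℕ.≤ n → ⟦ central k ⟧ ≈ ⟦ choose n k ⟧ * (- ⟦ 4 ⟧) ^ k
  central-low zero    _   = ≈-refl
  central-low (suc k) k<n = ≈-cancel k (suc<p k k<n) (begin
    ⟦ suc k ⟧ * ⟦ central (suc k) ⟧
      ≡⟨ central-rec-ℚ k ⟩
    ⟦ 2 ⟧ * (⟦ suc (k ℕ.+ k) ⟧ * ⟦ central k ⟧)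
      ≈⟨ ≈-*ℕ 2 (≈-*ℕ (suc (k ℕ.+ k)) (central-low k (ℕP.<⇒≤ k<n))) ⟩
    ⟦ 2 ⟧ * (⟦ suc (k ℕ.+ k) ⟧ * (⟦ choose n k ⟧ * (- ⟦ 4 ⟧) ^ k))
      ≈⟨ ≈-byP (⟦ 2 ⟧ * ⟦ choose n k ⟧ * (- ⟦ 4 ⟧) ^ k) quotient∈ (central-low-step k) ⟩
    ⟦ suc k ⟧ * (⟦ choose n (suc k) ⟧ * (- ⟦ 4 ⟧) ^ suc k) ∎)
    where
    open ≈-Reasoning
    quotient∈ : pIntegral p (⟦ 2 ⟧ * ⟦ choose n k ⟧ * (- ⟦ 4 ⟧) ^ k)
    quotient∈ = integral-* (⟦ 2 ⟧ * ⟦ choose n k ⟧) ((- ⟦ 4 ⟧) ^ k)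
                  (integral-* ⟦ 2 ⟧ ⟦ choose n k ⟧ (integral-⟦⟧ 2) (integral-⟦⟧ (choose n k)))
                  (integral-^ (- ⟦ 4 ⟧) k (integral-neg ⟦ 4 ⟧ (integral-⟦⟧ 4)))

  central-step≈0 : ∀ k → suc k ℕ.< p → ⟦ central k ⟧ ≈ 0ℚ → ⟦ central (suc k) ⟧ ≈ 0ℚ
  central-step≈0 k k+1<p central≈0 = ≈-cancel k k+1<p (begin
    ⟦ suc k ⟧ * ⟦ central (suc k) ⟧              ≡⟨ central-rec-ℚ k ⟩
    ⟦ 2 ⟧ * (⟦ suc (k ℕ.+ k) ⟧ * ⟦ central k ⟧)  ≈⟨ ≈-*ℕ 2 (≈-*ℕ (suc (k ℕ.+ k)) central≈0) ⟩
    ⟦ 2 ⟧ * (⟦ suc (k ℕ.+ k) ⟧ * 0ℚ)             ≡⟨ solve 2 (λ a K → con ⟦ 2 ⟧ :* (a :* con 0ℚ) := K :* con 0ℚ)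
                                                            refl ⟦ suc (k ℕ.+ k) ⟧ ⟦ suc k ⟧ ⟩
    ⟦ suc k ⟧ * 0ℚ                               ∎)
    where open ≈-Reasoning

  -- C(2k, k) ≡ 0 for n < k < p, starting from (n+1) C(2n+2, n+1) = 2p C(2n, n).
  central-high : ∀ i → suc (n ℕ.+ i) ℕ.< p → ⟦ central (suc (n ℕ.+ i)) ⟧ ≈ 0ℚ
  central-high zero    n+1<p rewrite ℕP.+-identityʳ n = ≈-cancel n n+1<p (begin
    ⟦ suc n ⟧ * ⟦ central (suc n) ⟧  ≡⟨ central-rec-ℚ n ⟩
    ⟦ 2 ⟧ * (P * ⟦ central n ⟧)      ≈⟨ ≈-byP (⟦ 2 ⟧ * ⟦ central n ⟧)
                                               (integral-* ⟦ 2 ⟧ ⟦ central n ⟧ (integral-⟦⟧ 2) (integral-⟦⟧ (central n)))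
                                               (solve 2 (λ P c → con ⟦ 2 ⟧ :* (P :* c) := con 0ℚ :+ P :* (con ⟦ 2 ⟧ :* c))
                                                        refl P ⟦ central n ⟧) ⟩
    0ℚ                               ≡⟨ sym (ℚP.*-zeroʳ ⟦ suc n ⟧) ⟩
    ⟦ suc n ⟧ * 0ℚ                   ∎)
    where open ≈-Reasoning
  central-high (suc i) n+i+2<p = subst (λ t → ⟦ central (suc t) ⟧ ≈ 0ℚ) (sym (ℕP.+-suc n i))
    (central-step≈0 (suc (n ℕ.+ i)) k+1<p (central-high i (ℕP.<-trans (ℕP.n<1+n _) k+1<p)))
    where
    k+1<p : suc (suc (n ℕ.+ i)) ℕ.< p
    k+1<p = subst (λ t → suc t ℕ.< p) (ℕP.+-suc n i) n+i+2<p

  integral-⅓ : pIntegral p 1/[1+ 2 ]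
  integral-⅓ = integral-1/[1+] 2 p>3

  integral-weight : ∀ j → suc j ℕ.< p → pIntegral p (1/[1+ j ] * 1/[1+ 2 ] ^ suc j)
  integral-weight j j+1<p = integral-* 1/[1+ j ] (1/[1+ 2 ] ^ suc j) (integral-1/[1+] j j+1<p)
                                       (integral-^ 1/[1+ 2 ] (suc j) integral-⅓)

  -- x = −4/3, so that 1 + x = ζ.
  x : ℚ
  x = - ⟦ 4 ⟧ * 1/[1+ 2 ]

  term-low : ∀ j → j ℕ.< n → term (suc j) ≈ ⟦ choose n (suc j) ⟧ * powerOver x (suc j)
  term-low j j<n = begin
    term (suc j)
      ≡⟨ term-as-product j ⟩
    ⟦ central (suc j) ⟧ * R
      ≈⟨ ≈-*ʳ R (integral-weight j (suc<p j j<n)) (central-low (suc j) j<n) ⟩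
    (⟦ choose n (suc j) ⟧ * (- ⟦ 4 ⟧) ^ suc j) * (1/[1+ j ] * 1/[1+ 2 ] ^ suc j)
      ≡⟨ solve 4 (λ B W r T → (B :* W) :* (r :* T) := B :* ((W :* T) :* r)) refl
               ⟦ choose n (suc j) ⟧ ((- ⟦ 4 ⟧) ^ suc j) 1/[1+ j ] (1/[1+ 2 ] ^ suc j) ⟩
    ⟦ choose n (suc j) ⟧ * (((- ⟦ 4 ⟧) ^ suc j * 1/[1+ 2 ] ^ suc j) * 1/[1+ j ])
      ≡⟨ cong (λ t → ⟦ choose n (suc j) ⟧ * (t * 1/[1+ j ])) (sym (^-distrib-* (- ⟦ 4 ⟧) 1/[1+ 2 ] (suc j))) ⟩
    ⟦ choose n (suc j) ⟧ * powerOver x (suc j) ∎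
    where
    open ≈-Reasoning
    R : ℚ
    R = 1/[1+ j ] * 1/[1+ 2 ] ^ suc j

  term-high : ∀ i → i ℕ.< n → term (n ℕ.+ suc i) ≈ 0ℚ
  term-high i i<n = begin
    term (n ℕ.+ suc i)
      ≡⟨ cong term (ℕP.+-suc n i) ⟩
    term (suc (n ℕ.+ i))
      ≡⟨ term-as-product (n ℕ.+ i) ⟩
    ⟦ central (suc (n ℕ.+ i)) ⟧ * R
      ≈⟨ ≈-*ʳ R (integral-weight (n ℕ.+ i) n+i+1<p) (central-high i n+i+1<p) ⟩
    0ℚ * R
      ≡⟨ ℚP.*-zeroˡ R ⟩
    0ℚ ∎
    where
    open ≈-Reasoning
    R : ℚ
    R = 1/[1+ n ℕ.+ i ] * 1/[1+ 2 ] ^ suc (n ℕ.+ i)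
    n+i+1<p : suc (n ℕ.+ i) ℕ.< p
    n+i+1<p = ℕ.s≤s (ℕP.+-monoʳ-< n i<n)

  sum≈logs : sumFrom1 (n ℕ.+ n) term ≈ logSum n ζ - logSum n 1ℚ
  sum≈logs = begin
    sumFrom1 (n ℕ.+ n) term
      ≡⟨ Σ-split n n term ⟩
    sumFrom1 n term + sumFrom1 n (λ k → term (n ℕ.+ k))
      ≈⟨ ≈-+ (Σ-≈ n term-low) (Σ-≈ n term-high) ⟩
    sumFrom1 n (λ k → ⟦ choose n k ⟧ * powerOver x k) + sumFrom1 n (λ _ → 0ℚ)
      ≡⟨ cong₂ _+_ (binomial-log-identity n x) (Σ-zero n (λ _ _ → refl)) ⟩
    (logSum n ζ - logSum n 1ℚ) + 0ℚ
      ≡⟨ ℚP.+-identityʳ (logSum n ζ - logSum n 1ℚ) ⟩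
    logSum n ζ - logSum n 1ℚ ∎
    where open ≈-Reasoning

  oddOver : ℚ → ℕ → ℚ
  oddOver z zero    = 0ℚ
  oddOver z (suc i) = ⟦ choose (n ℕ.+ n) (suc (i ℕ.+ i)) ⟧ * powerOver z (suc i)

  W : ℚ → ℚ
  W z = sumFrom1 n (oddOver z)

  integral-powerOver : ∀ z i → pIntegral p z → i ℕ.< n → pIntegral p (powerOver z (suc i))
  integral-powerOver z i z∈ i<n =
    integral-* (z ^ suc i) 1/[1+ i ] (integral-^ z (suc i) z∈) (integral-1/[1+] i (suc<p i i<n))

  integral-W : ∀ z → pIntegral p z → pIntegral p (W z)
  integral-W z z∈ = integral-Σ n (oddOver z) (λ i i<n →
    integral-* ⟦ choose (n ℕ.+ n) (suc (i ℕ.+ i)) ⟧ (powerOver z (suc i))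
               (integral-⟦⟧ (choose (n ℕ.+ n) (suc (i ℕ.+ i)))) (integral-powerOver z i z∈ i<n))

  -- Step 2a:  L_n(z) ≡ −W(z), because C(p−1, 2i−1) ≡ (−1)^{2i−1} = −1.
  log≈ : ∀ z → pIntegral p z → logSum n z ≈ - 1ℚ * W z
  log≈ z z∈ = begin
    logSum n z                              ≈⟨ Σ-≈ n termwise ⟩
    sumFrom1 n (λ k → - 1ℚ * oddOver z k)   ≡⟨ Σ-* n (- 1ℚ) (oddOver z) ⟩
    - 1ℚ * W z                              ∎
    where
    open ≈-Reasoning
    termwise : ∀ i → i ℕ.< n → powerOver z (suc i) ≈ - 1ℚ * oddOver z (suc i)
    termwise i i<n = begin
      w                       ≡⟨ solve 1 (λ w → w := (:- con 1ℚ) :* ((:- con 1ℚ) :* w)) refl w ⟩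
      - 1ℚ * (- 1ℚ * w)       ≈⟨ ≈-*ˡ (- 1ℚ) (integral-neg 1ℚ ¬p∣1)
                                       (≈-*ʳ w (integral-powerOver z i z∈ i<n) (≈-sym C≈-1)) ⟩
      - 1ℚ * (C * w)          ∎
      where
      w C : ℚ
      w = powerOver z (suc i)
      C = ⟦ choose (n ℕ.+ n) (suc (i ℕ.+ i)) ⟧
      C≈-1 : C ≈ - 1ℚ
      C≈-1 = ≈-trans (choose-2n (suc (i ℕ.+ i)) (ℕP.+-mono-< i<n i<n)) (≈-reflexive (neg-one^odd i))

  -- Step 2b:  2 Σ_{i=1}^n C(p, 2i) z^i = p W(z), because 2i C(p, 2i) = p C(p−1, 2i−1);
  -- hence E_p(z) = 1 + p·W(z)/2 exactly.
  evenSum≡ : ∀ z → ⟦ 2 ⟧ * sumFrom1 n (evenTerm p z) ≡ P * W z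
  evenSum≡ z = trans (sym (Σ-* n ⟦ 2 ⟧ (evenTerm p z)))
                     (trans (Σ-cong n (λ i _ → termwise i)) (Σ-* n P (oddOver z)))
    where
    termwise : ∀ i → ⟦ 2 ⟧ * evenTerm p z (suc i) ≡ P * oddOver z (suc i)
    termwise i = begin
      ⟦ 2 ⟧ * (E * w)                            ≡⟨ sym (ℚP.*-assoc ⟦ 2 ⟧ E w) ⟩
      (⟦ 2 ⟧ * E) * w                            ≡⟨ cong (_* w) (sym (1/[1+]-cancel i (⟦ 2 ⟧ * E))) ⟩
      (1/[1+ i ] * (⟦ suc i ⟧ * (⟦ 2 ⟧ * E))) * w  ≡⟨ cong (λ t → (1/[1+ i ] * t) * w) twice ⟩
      (1/[1+ i ] * (P * O)) * w                  ≡⟨ solve 4 (λ r P O w → (r :* (P :* O)) :* w := P :* (O :* (w :* r)))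
                                                            refl 1/[1+ i ] P O w ⟩
      P * (O * (w * 1/[1+ i ]))                  ∎
      where
      open ≡-Reasoning
      E O w : ℚ
      E = ⟦ choose p (suc (suc (i ℕ.+ i))) ⟧
      O = ⟦ choose (n ℕ.+ n) (suc (i ℕ.+ i)) ⟧
      w = z ^ suc i
      twice : ⟦ suc i ⟧ * (⟦ 2 ⟧ * E) ≡ P * O
      twice = begin
        ⟦ suc i ⟧ * (⟦ 2 ⟧ * E)      ≡⟨ sym (ℚP.*-assoc ⟦ suc i ⟧ ⟦ 2 ⟧ E) ⟩
        ⟦ suc i ⟧ * ⟦ 2 ⟧ * E        ≡⟨ cong (_* E) (sym (⟦*⟧ (suc i) 2)) ⟩
        ⟦ suc i ℕ.* 2 ⟧ * E          ≡⟨ cong (λ t → ⟦ t ⟧ * E)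
                                            (N.solve 1 (λ i → (N.con 1 N.:+ i) N.:* N.con 2 N.:= N.con 2 N.:+ (i N.:+ i)) refl i) ⟩
        ⟦ suc (suc (i ℕ.+ i)) ⟧ * E  ≡⟨ choose-absorb-ℚ (n ℕ.+ n) (suc (i ℕ.+ i)) ⟩
        P * O                        ∎
        where module N = NatSolver.+-*-Solver

  b : ℚ → ℚ
  b z = W z * 1/[1+ 1 ]

  integral-b : ∀ z → pIntegral p z → pIntegral p (b z)
  integral-b z z∈ = integral-* (W z) 1/[1+ 1 ] (integral-W z z∈) (integral-1/[1+] 1 (ℕP.<-trans (ℕP.n<1+n 2) p>3))

  integral-ζ : pIntegral p ζ
  integral-ζ = integral-neg 1/[1+ 2 ] integral-⅓

  evenPart-p : ∀ z → evenPart z p ≡ 1ℚ + P * b z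
  evenPart-p z = begin
    evenPart z p                    ≡⟨ sym (evenPart-as-sum n z) ⟩
    1ℚ + T                          ≡⟨ cong (λ t → 1ℚ + t)
                                            (solve 1 (λ T → T := con 1/[1+ 1 ] :* (con ⟦ 2 ⟧ :* T)) refl T) ⟩
    1ℚ + 1/[1+ 1 ] * (⟦ 2 ⟧ * T)    ≡⟨ cong (λ t → 1ℚ + 1/[1+ 1 ] * t) (evenSum≡ z) ⟩
    1ℚ + 1/[1+ 1 ] * (P * W z)      ≡⟨ cong (λ t → 1ℚ + t)
                                            (solve 3 (λ h P w → h :* (P :* w) := P :* (w :* h)) refl 1/[1+ 1 ] P (W z)) ⟩
    1ℚ + P * b z                    ∎
    where
    open ≡-Reasoning
    T : ℚ
    T = sumFrom1 n (evenTerm p z)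

  sum≈halves : sumFrom1 (n ℕ.+ n) term ≈ ⟦ 2 ⟧ * b 1ℚ - ⟦ 2 ⟧ * b ζ
  sum≈halves = begin
    sumFrom1 (n ℕ.+ n) term     ≈⟨ sum≈logs ⟩
    logSum n ζ - logSum n 1ℚ    ≈⟨ ≈-+ (log≈ ζ integral-ζ) (≈-neg (log≈ 1ℚ ¬p∣1)) ⟩
    - 1ℚ * W ζ - - 1ℚ * W 1ℚ    ≡⟨ solve 2 (λ wζ w₁ → :- con 1ℚ :* wζ :- :- con 1ℚ :* w₁
                                             := con ⟦ 2 ⟧ :* (w₁ :* con 1/[1+ 1 ]) :- con ⟦ 2 ⟧ :* (wζ :* con 1/[1+ 1 ]))
                                           refl (W ζ) (W 1ℚ) ⟩
    ⟦ 2 ⟧ * b 1ℚ - ⟦ 2 ⟧ * b ζ  ∎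
    where open ≈-Reasoning

  fermatQuot3≡ : fermatQuot3 p ≡ (⟦ 3 ⟧ ^ n * ⟦ 3 ⟧ ^ n - 1ℚ) * 1/[1+ n ℕ.+ n ]
  fermatQuot3≡ = begin
    fermatQuot3 p
      ≡⟨ sym (ι*1/[1+ (+ (3 ℕ.^ (n ℕ.+ n)) ℤ.- + 1) ] (n ℕ.+ n)) ⟩
    ι (+ (3 ℕ.^ (n ℕ.+ n)) ℤ.- + 1) * 1/[1+ n ℕ.+ n ]
      ≡⟨ cong (_* 1/[1+ n ℕ.+ n ]) (trans (ι-+ (+ (3 ℕ.^ (n ℕ.+ n))) (ℤ.- + 1))
                                          (cong (λ t → ⟦ 3 ℕ.^ (n ℕ.+ n) ⟧ + t) (ι-neg (+ 1)))) ⟩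
    (⟦ 3 ℕ.^ (n ℕ.+ n) ⟧ - 1ℚ) * 1/[1+ n ℕ.+ n ]
      ≡⟨ cong (λ t → (t - 1ℚ) * 1/[1+ n ℕ.+ n ]) (trans (⟦^⟧ 3 (n ℕ.+ n)) (^-homo-* ⟦ 3 ⟧ n n)) ⟩
    (⟦ 3 ⟧ ^ n * ⟦ 3 ⟧ ^ n - 1ℚ) * 1/[1+ n ℕ.+ n ] ∎
    where open ≡-Reasoning

  congruence-from-norm : ∀ ε → Sign ε → ⟦ 3 ⟧ ^ n * evenPart ζ p ≡ ε * evenPart 1ℚ p →
                         sumFrom1 (n ℕ.+ n) term ≡ fermatQuot3 p [modℚ p ]
  congruence-from-norm ε ε-sign norm =
    ≈⇒≡[modℚ] (≈-trans sum≈halves twice≈q) (≈-integral (≈-sym twice≈q) twice∈)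
    where
    c d Z : ℚ
    c = ⟦ 3 ⟧ ^ n
    d = ε * b 1ℚ - b ζ * c
    Z = ⟦ 2 ⟧ * ε * b ζ * d - d * d

    ε∈ : pIntegral p ε
    ε∈ = integral-sign ε-sign
    b₁∈ : pIntegral p (b 1ℚ)
    b₁∈ = integral-b 1ℚ ¬p∣1
    bζ∈ : pIntegral p (b ζ)
    bζ∈ = integral-b ζ integral-ζ
    d∈ : pIntegral p d
    d∈ = integral-- (ε * b 1ℚ) (b ζ * c) (integral-* ε (b 1ℚ) ε∈ b₁∈)
                    (integral-* (b ζ) c bζ∈ (integral-^ ⟦ 3 ⟧ n (integral-⟦⟧ 3)))
    Z∈ : pIntegral p Z
    Z∈ = integral-- (⟦ 2 ⟧ * ε * b ζ * d) (d * d)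
           (integral-* (⟦ 2 ⟧ * ε * b ζ) d
              (integral-* (⟦ 2 ⟧ * ε) (b ζ) (integral-* ⟦ 2 ⟧ ε (integral-⟦⟧ 2) ε∈) bζ∈) d∈)
           (integral-* d d d∈ d∈)
    twice∈ : pIntegral p (⟦ 2 ⟧ * b 1ℚ - ⟦ 2 ⟧ * b ζ)
    twice∈ = integral-- (⟦ 2 ⟧ * b 1ℚ) (⟦ 2 ⟧ * b ζ)
               (integral-* ⟦ 2 ⟧ (b 1ℚ) (integral-⟦⟧ 2) b₁∈) (integral-* ⟦ 2 ⟧ (b ζ) (integral-⟦⟧ 2) bζ∈)

    norm′ : c * (1ℚ + P * b ζ) ≡ ε * (1ℚ + P * b 1ℚ)
    norm′ = trans (cong (c *_) (sym (evenPart-p ζ))) (trans norm (cong (ε *_) (evenPart-p 1ℚ)))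

    twice≈q : ⟦ 2 ⟧ * b 1ℚ - ⟦ 2 ⟧ * b ζ ≈ fermatQuot3 p
    twice≈q = ≈-by Z Z∈ (trans (cong (λ t → (⟦ 2 ⟧ * b 1ℚ - ⟦ 2 ⟧ * b ζ) - t) fermatQuot3≡)
      (fermat-quotient-identity P 1/[1+ n ℕ.+ n ] ε (b 1ℚ) (b ζ) c
                                (1/[1+]-inverse (n ℕ.+ n)) (Sign-square ε-sign) norm′))

halve : ∀ m → Σ ℕ (λ n → m ≡ n ℕ.+ n ⊎ m ≡ suc (n ℕ.+ n))
halve zero = 0 , inj₁ refl
halve (suc m) with halve m
... | n , inj₁ m≡2n   = n , inj₂ (cong suc m≡2n)
... | n , inj₂ m≡2n+1 = suc n , inj₁ (cong suc (trans m≡2n+1 (sym (ℕP.+-suc n n))))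

no-small-divisor : ∀ {p} d → Prime p → 3 ℕ.< p → 1 ℕ.< d → d ℕ.≤ 3 → ¬ d ∣ p
no-small-divisor d p-prime p>3 1<d d≤3 d∣p with prime⇒irreducible p-prime d∣p
... | inj₁ refl = ℕP.<-irrefl refl 1<d
... | inj₂ refl = ℕP.<-irrefl refl (ℕP.<-≤-trans p>3 d≤3)

prime-odd : ∀ {p} → Prime p → 3 ℕ.< p → Σ ℕ (λ n → p ≡ suc (n ℕ.+ n))
prime-odd {p} p-prime p>3 with halve p
... | n , inj₂ p≡2n+1 = n , p≡2n+1
... | n , inj₁ p≡2n   = contradiction 2∣p (no-small-divisor 2 p-prime p>3 (ℕ.s≤s (ℕ.s≤s ℕ.z≤n)) (ℕP.n≤1+n 2))
  where
  2∣p : 2 ∣ p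
  2∣p = divides n (trans p≡2n (trans (cong (n ℕ.+_) (sym (ℕP.+-identityʳ n))) (ℕP.*-comm 2 n)))

lemma2p4 : (p : ℕ) → (pr : Prime p) → p > 3 →
    sumFrom1 (p ∸ 1) term ≡ fermatQuot3 p {{prime⇒nonZero pr}} [modℚ p ]
lemma2p4 p pr p>3 with prime-odd pr p>3
... | n , refl with evenPart-ζ n
...   | inj₁ 3∣p = contradiction 3∣p (no-small-divisor 3 pr p>3 (ℕ.s≤s (ℕ.s≤s ℕ.z≤n)) ℕP.≤-refl)
...   | inj₂ (ε , ε-sign , norm) =
  OddPrime.congruence-from-norm n pr p>3 ε ε-sign (trans norm (cong (ε *_) (sym (evenPart-one n))))
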